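{- For every constant $s>0$ there is a constant $d$ (depending only on $s$) such that the following holds. Let $G$ be a graph on $n\ge2$ vertices admitting an ordering $v_1,\dots,v_n$ of its vertices such that $|N(v_i)\cap\{v_{i+1},\dots,v_n\}|\le n^{s/\sqrt{\log n}}$ for every $i\in\{1,\dots,n-1\}$. Then $G$ admits a CS-Separator of size at most $n^{d}$ (i.e. of size $n^{\mathcal{O}(1)}$).
   Context: A cut of $G$ is a partition $(W,W')$ of $V(G)$; it separates disjoint $K,S$ if $K\subseteq W$ and $S\subseteq W'$. A CS-Separator of $G$ is a family of cuts such that for every clique $K$ and stable set $S$ with $K\cap S=\emptyset$ some cut separates $K$ and $S$; its size is the number of cuts. $N(v)$ denotes the neighborhood of $v$.
   Formalization: The constant s ranges over the positive rationals. -}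

module Defs where

open import Data.Nat using (ℕ; zero; suc; _+_; _*_; _^_; _≤_; _<_)
open import Data.Bool using (Bool; true; false; if_then_else_)
open import Data.Fin using (Fin; zero; suc; toℕ)
open import Data.Fin.Permutation using (Permutation′; _⟨$⟩ʳ_)
open import Data.List using (List; length)
open import Data.List.Membership.Propositional using (_∈_)
open import Data.Product using (Σ; _×_; ∃-syntax)
open import Relation.Binary.PropositionalEquality using (_≡_; _≢_)

record Graph (n : ℕ) : Set where
  field
    adj   : Fin n → Fin n → Bool
    sym   : ∀ u v → adj u v ≡ adj v u
    irrfl : ∀ v → adj v v ≡ false
open Graph public

VSet : ℕ → Set
VSet n = Fin n → Bool

_∈ᵥ_ : ∀ {n} → Fin n → VSet n → Set
v ∈ᵥ A = A v ≡ true

count : ∀ {n} → (Fin n → Bool) → ℕ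
count {zero}  P = 0
count {suc n} P = (if P zero then 1 else 0) + count (λ j → P (suc j))

IsClique : ∀ {n} → Graph n → VSet n → Set
IsClique G K = ∀ u v → u ∈ᵥ K → v ∈ᵥ K → u ≢ v → adj G u v ≡ true

IsStable : ∀ {n} → Graph n → VSet n → Set
IsStable G S = ∀ u v → u ∈ᵥ S → v ∈ᵥ S → adj G u v ≡ false

Disjoint : ∀ {n} → VSet n → VSet n → Set
Disjoint K S = ∀ v → v ∈ᵥ K → v ∈ᵥ S → Data.Empty.⊥
  where import Data.Empty

-- A cut (W, W') is represented by W; W' is the complement of W.
Cut : ℕ → Set
Cut = VSet

Separates : ∀ {n} → Cut n → VSet n → VSet n → Set
Separates W K S = (∀ v → v ∈ᵥ K → W v ≡ true) × (∀ v → v ∈ᵥ S → W v ≡ false)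

IsCSSeparator : ∀ {n} → Graph n → List (Cut n) → Set
IsCSSeparator G F =
  ∀ K S → IsClique G K → IsStable G S → Disjoint K S →
  ∃[ W ] (W ∈ F × Separates W K S)

-- "k ≤ n ^ (s / √(log₂ n))" for s = p / q (p, q ≥ 1) and n ≥ 2, expressed
-- exactly without reals.  With x = log₂ k (k ≥ 1) this is x² ≤ s² log₂ n,
-- which holds iff every rational 0 ≤ u/v < x satisfies (u/v)² ≤ s² log₂ n,
-- i.e. iff for all u, v ≥ 1:  2^u < k^v  →  2^(u²q²) ≤ n^(p²v²).
-- (For k = 0 and k = 1 the hypothesis 2^u < k^v never holds: consistent.)
BoundedBy : (n p q k : ℕ) → Set
BoundedBy n p q k =
  ∀ u v → 1 ≤ v → 2 ^ u < k ^ v → 2 ^ (u * u * (q * q)) ≤ n ^ (p * p * (v * v))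

fwdDeg : ∀ {n} → Graph n → Permutation′ n → Fin n → ℕ
fwdDeg G σ i = count (λ j → (toℕ i <ᵇ toℕ j) ∧ adj G (σ ⟨$⟩ʳ i) (σ ⟨$⟩ʳ j))
  where open import Data.Nat using (_<ᵇ_)
        open import Data.Bool using (_∧_)

{-# OPTIONS --safe #-}
-- Yannakakis' branching argument. To separate a clique K from a disjoint stable
-- set S, keep candidate sets A ⊇ K and B ⊇ S and let C = A ∩ B. If some x ∈ K ∩ C
-- has at most |C|/2 neighbours in C, guessing x shrinks A to A ∩ N[x] and drops x
-- from B, halving C; dually for a y ∈ S ∩ C with at most |C|/2 non-neighbours in
-- C. If neither exists, vertices of K ∩ C have more and vertices of S ∩ C fewer
-- than |C|/2 neighbours in C, so (A ∖ B) ∪ {v ∈ C : deg_C v > |C|/2} separates K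
-- from S. With |C| < 2^t this needs (1 + 2|C|)^t cuts. Starting from the first
-- vertex i of K in the ordering, C is the forward neighbourhood of i, of size
-- k ≤ n^(s/√log n); with t ≈ log k this is 2^O(log² k) = n^O(s²) cuts per i.
module Submission where

open import Defs hiding (sym)
import Data.Bool as Bool
open import Data.Bool using (true; false; not; _∧_; _∨_; if_then_else_)
open import Data.Bool.Properties using (∧-conicalˡ; ∧-conicalʳ; ∨-zeroʳ; not-injective; not-¬; ¬-not; T-≡)
open import Data.Empty using (⊥; ⊥-elim)
open import Data.Fin using (Fin; zero; suc; toℕ; _≟_)
open import Data.Fin.Permutation using (Permutation′; _⟨$⟩ʳ_; _⟨$⟩ˡ_; inverseʳ)
open import Data.Fin.Properties using (any?; toℕ-injective)
open import Data.List using (List; []; _∷_; _++_; length; map)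
open import Data.List.Membership.Propositional using (_∈_)
open import Data.List.Membership.Propositional.Properties using (∈-++⁺ˡ; ∈-++⁺ʳ; ∈-map⁺)
open import Data.List.Properties using (length-++; length-map)
open import Data.List.Relation.Unary.Any using (here; there)
open import Data.Nat using (ℕ; zero; suc; _+_; _*_; _^_; _≤_; _<_; _<ᵇ_; z≤n; s≤s; _≤?_; _<?_)
open import Data.Nat.Properties hiding (_≟_)
open import Data.Nat.Tactic.RingSolver using (solve-∀)
open import Data.Product using (_×_; _,_; proj₁; proj₂; ∃-syntax)
open import Data.Sum using (_⊎_; inj₁; inj₂)
import Data.Sum as Sum
open import Function using (_∘_; case_of_)
open import Function.Bundles using (Equivalence; Injection)
open import Function.Properties.Inverse using (Inverse⇒Injection)
open import Relation.Binary.PropositionalEquality using (_≡_; _≢_; refl; sym; trans; cong; cong₂; subst)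
open import Relation.Nullary using (¬_; Dec; yes; no; does)
open import Relation.Nullary.Decidable using (dec-true; dec-false; _×-dec_)

private variable
  n : ℕ
  A B X : VSet n
  j x : Fin n

infix  4 _⊆_
infixr 7 _∩_ _∖_
infixr 6 _∪_

_⊆_ : VSet n → VSet n → Set
A ⊆ B = ∀ j → j ∈ᵥ A → j ∈ᵥ B

∅ : VSet n
∅ _ = false

⁅_⁆ : Fin n → VSet n
⁅ x ⁆ j = does (j ≟ x)

∁ : VSet n → VSet n
∁ A j = not (A j)

_∩_ _∪_ _∖_ : VSet n → VSet n → VSet n
(A ∩ B) j = A j ∧ B j
(A ∪ B) j = A j ∨ B j
A ∖ B = A ∩ ∁ B

∧-true⁺ : ∀ {x y} → x ≡ true → y ≡ true → x ∧ y ≡ true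
∧-true⁺ = cong₂ _∧_

∧-true⁻ : ∀ x {y} → x ∧ y ≡ true → x ≡ true × y ≡ true
∧-true⁻ x {y} e = ∧-conicalˡ x y e , ∧-conicalʳ x y e

∨-true⁺ˡ : ∀ {x y} → x ≡ true → x ∨ y ≡ true
∨-true⁺ˡ {y = y} = cong (_∨ y)

∨-true⁺ʳ : ∀ {x y} → y ≡ true → x ∨ y ≡ true
∨-true⁺ʳ {x} e = trans (cong (x ∨_) e) (∨-zeroʳ x)

∨-true⁻ : ∀ x {y} → x ∨ y ≡ true → x ≡ true ⊎ y ≡ true
∨-true⁻ true  _ = inj₁ refl
∨-true⁻ false e = inj₂ e

not-true⁺ : ∀ {x} → x ≡ false → not x ≡ true
not-true⁺ = cong not

not-true⁻ : ∀ x → not x ≡ true → x ≢ true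
not-true⁻ _ e = not-¬ (not-injective e)

⊆-∁⁅⁆ : ∀ (A : VSet n) → ¬ x ∈ᵥ A → A ⊆ ∁ ⁅ x ⁆
⊆-∁⁅⁆ {x = x} _ x∉A j j∈A = not-true⁺ (dec-false (j ≟ x) λ { refl → x∉A j∈A })

⊆-trans : A ⊆ B → B ⊆ X → A ⊆ X
⊆-trans A⊆B B⊆X j j∈A = B⊆X j (A⊆B j j∈A)

⊆-∩ : X ⊆ A → X ⊆ B → X ⊆ A ∩ B
⊆-∩ X⊆A X⊆B j j∈X = ∧-true⁺ (X⊆A j j∈X) (X⊆B j j∈X)

∩-⊆ˡ : ∀ (A B : VSet n) → A ∩ B ⊆ A
∩-⊆ˡ A B j j∈ = proj₁ (∧-true⁻ (A j) j∈)

∪-∖-⊆ : ∀ (A B : VSet n) → (A ∪ B) ∖ A ⊆ B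
∪-∖-⊆ A B j j∈ with ∧-true⁻ (A j ∨ B j) j∈
... | j∈A∪B , j∉A with ∨-true⁻ (A j) j∈A∪B
...   | inj₁ j∈A = ⊥-elim (not-true⁻ (A j) j∉A j∈A)
...   | inj₂ j∈B = j∈B

count-mono : A ⊆ B → count A ≤ count B
count-mono {zero}  A⊆B = z≤n
count-mono {suc n} {A} {B} A⊆B with A zero in a₀ | B zero in b₀
... | true  | true  = s≤s (count-mono (λ j → A⊆B (suc j)))
... | true  | false = ⊥-elim (not-¬ b₀ (A⊆B zero a₀))
... | false | true  = m≤n⇒m≤1+n (count-mono (λ j → A⊆B (suc j)))
... | false | false = count-mono (λ j → A⊆B (suc j))

count-∩+count-∖ : ∀ (A B : VSet n) → count (A ∩ B) + count (A ∖ B) ≡ count A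
count-∩+count-∖ {zero}  A B = refl
count-∩+count-∖ {suc n} A B with A zero | B zero
... | true  | true  = cong suc (count-∩+count-∖ (λ j → A (suc j)) (λ j → B (suc j)))
... | true  | false = trans (+-suc _ _) (cong suc (count-∩+count-∖ (λ j → A (suc j)) (λ j → B (suc j))))
... | false | _     = count-∩+count-∖ (λ j → A (suc j)) (λ j → B (suc j))

count>0 : ∀ (A : VSet n) {j} → j ∈ᵥ A → 0 < count A
count>0 A {zero}  e rewrite e = s≤s z≤n
count>0 A {suc j} e = ≤-trans (count>0 (λ i → A (suc i)) e) (m≤n+m _ _)

count-⊤ : count {n} (λ _ → true) ≡ n
count-⊤ {zero}  = refl
count-⊤ {suc n} = cong suc count-⊤

concatWhere : {T : Set} → VSet n → (Fin n → List T) → List T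
concatWhere {zero}  P f = []
concatWhere {suc n} P f =
  (if P zero then f zero else []) ++ concatWhere (λ j → P (suc j)) (λ j → f (suc j))

∈-concatWhere : ∀ {T : Set} {c : T} (P : VSet n) (f : Fin n → List T) →
                x ∈ᵥ P → c ∈ f x → c ∈ concatWhere P f
∈-concatWhere {x = zero}  P f x∈P c∈fx rewrite x∈P = ∈-++⁺ˡ c∈fx
∈-concatWhere {x = suc x} P f x∈P c∈fx =
  ∈-++⁺ʳ _ (∈-concatWhere (λ j → P (suc j)) (λ j → f (suc j)) x∈P c∈fx)

length-concatWhere : ∀ {T : Set} (P : VSet n) (f : Fin n → List T) M →
                     (∀ x → x ∈ᵥ P → length (f x) ≤ M) →
                     length (concatWhere P f) ≤ count P * M
length-concatWhere {zero}  P f M bound = z≤n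
length-concatWhere {suc n} P f M bound with P zero in p₀
... | true  = ≤-trans (≤-reflexive (length-++ (f zero)))
                      (+-mono-≤ (bound zero p₀) (length-concatWhere _ _ M (λ x → bound (suc x))))
... | false = length-concatWhere _ _ M (λ x → bound (suc x))

empty-or-least : ∀ (P : VSet n) →
                   (∀ j → P j ≡ false) ⊎ ∃[ i ] (i ∈ᵥ P × ∀ j → j ∈ᵥ P → toℕ i ≤ toℕ j)
empty-or-least {zero}  P = inj₁ λ ()
empty-or-least {suc n} P with P zero in p₀ | empty-or-least (λ j → P (suc j))
... | true  | _ = inj₂ (zero , p₀ , λ _ _ → z≤n)
... | false | inj₁ empty = inj₁ λ { zero → p₀ ; (suc j) → empty j }
... | false | inj₂ (i , i∈P , least) = inj₂ (suc i , i∈P , λ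
  { zero    zero∈P → ⊥-elim (not-¬ p₀ zero∈P)
  ; (suc j) j∈P    → s≤s (least j j∈P) })

halve : ∀ {c d} t → 2 * d ≤ c → c < 2 ^ suc t → d < 2 ^ t
halve {d = d} t 2d≤c c<2^[1+t] = *-cancelˡ-< 2 d (2 ^ t) (≤-<-trans 2d≤c c<2^[1+t])

no-two-majorities : ∀ a b {c} → a + b ≡ c → c < 2 * a → c < 2 * b → ⊥
no-two-majorities a b refl c<2a c<2b =
  <-irrefl refl (≤-trans (+-mono-< c<2a c<2b) (≤-reflexive (double-sum a b)))
  where
  double-sum : ∀ a b → 2 * a + 2 * b ≡ (a + b) + (a + b)
  double-sum = solve-∀

branching-size : ∀ {a c m} → a ≤ c → 1 ≤ m → 1 + a * (m + m) ≤ (1 + 2 * c) * m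
branching-size {c = c} {m} a≤c 1≤m =
  ≤-trans (+-mono-≤ 1≤m (*-monoˡ-≤ (m + m) a≤c)) (≤-reflexive (factor c m))
  where
  factor : ∀ c m → m + c * (m + m) ≡ (1 + 2 * c) * m
  factor = solve-∀

light-or-heavy : ∀ (X C : VSet n) (f : Fin n → ℕ) →
  (∃[ x ] (x ∈ᵥ X × x ∈ᵥ C × 2 * f x ≤ count C)) ⊎ (∀ x → x ∈ᵥ X → x ∈ᵥ C → count C < 2 * f x)
light-or-heavy X C f
  with any? (λ x → (X x Bool.≟ true) ×-dec (C x Bool.≟ true) ×-dec (2 * f x ≤? count C))
... | yes light = inj₁ light
... | no ¬light = inj₂ λ x x∈X x∈C → ≰⇒> λ 2fx≤|C| → ¬light (x , x∈X , x∈C , 2fx≤|C|)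

from-does : ∀ {P : Set} (P? : Dec P) → does P? ≡ true → P
from-does (yes p) _ = p

module CliqueStableCuts {n : ℕ} (G : Graph n) where

  N N[_] : Fin n → VSet n
  N = adj G
  N[ x ] = ⁅ x ⁆ ∪ N x

  deg nonDeg : VSet n → Fin n → ℕ
  deg    C x = count (C ∩ N x)
  nonDeg C x = count (C ∖ N x)

  heavy : VSet n → VSet n
  heavy C x = does (count C <? 2 * deg C x)

  finalCut : VSet n → VSet n → Cut n
  finalCut A B = (A ∖ B) ∪ ((A ∩ B) ∩ heavy (A ∩ B))

  cuts : ℕ → VSet n → VSet n → List (Cut n)
  cuts zero    A B = finalCut A B ∷ []
  cuts (suc t) A B = finalCut A B ∷ concatWhere (A ∩ B) λ x →
    cuts t (A ∩ N[ x ]) (B ∖ ⁅ x ⁆) ++ cuts t (A ∖ ⁅ x ⁆) (B ∖ N x)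

  clique-branch-⊆ : ∀ A B x → (A ∩ N[ x ]) ∩ (B ∖ ⁅ x ⁆) ⊆ (A ∩ B) ∩ N x
  clique-branch-⊆ A B x j j∈ =
    let j∈A∩N[x] , j∈B∖x = ∧-true⁻ (A j ∧ N[ x ] j) j∈
        j∈A , j∈N[x] = ∧-true⁻ (A j) j∈A∩N[x]
        j∈B , j∉x = ∧-true⁻ (B j) j∈B∖x
    in ∧-true⁺ (∧-true⁺ j∈A j∈B) (∪-∖-⊆ ⁅ x ⁆ (N x) j (∧-true⁺ j∈N[x] j∉x))

  stable-branch-⊆ : ∀ A B y → (A ∖ ⁅ y ⁆) ∩ (B ∖ N y) ⊆ (A ∩ B) ∖ N y
  stable-branch-⊆ A B y j j∈ =
    let j∈A∖y , j∈B∖Ny = ∧-true⁻ (A j ∧ not (⁅ y ⁆ j)) j∈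
        j∈A , _ = ∧-true⁻ (A j) j∈A∖y
        j∈B , j∉Ny = ∧-true⁻ (B j) j∈B∖Ny
    in ∧-true⁺ (∧-true⁺ j∈A j∈B) j∉Ny

  length-cuts : ∀ t A B {c} → count (A ∩ B) ≤ c → length (cuts t A B) ≤ (1 + 2 * c) ^ t
  length-cuts zero    A B _ = ≤-refl
  length-cuts (suc t) A B {c} |C|≤c =
    ≤-trans (s≤s (length-concatWhere (A ∩ B) _ (L + L) branches))
            (branching-size |C|≤c (m^n>0 (1 + 2 * c) t))
    where
    L : ℕ
    L = (1 + 2 * c) ^ t
    shrinks : ∀ {C′} → C′ ⊆ A ∩ B → count C′ ≤ c
    shrinks C′⊆C = ≤-trans (count-mono C′⊆C) |C|≤c
    branches : ∀ x → x ∈ᵥ (A ∩ B) →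
               length (cuts t (A ∩ N[ x ]) (B ∖ ⁅ x ⁆) ++ cuts t (A ∖ ⁅ x ⁆) (B ∖ N x)) ≤ L + L
    branches x _ = ≤-trans (≤-reflexive (length-++ (cuts t (A ∩ N[ x ]) (B ∖ ⁅ x ⁆))))
      (+-mono-≤ (length-cuts t _ _ (shrinks (⊆-trans (clique-branch-⊆ A B x) (∩-⊆ˡ (A ∩ B) (N x)))))
                (length-cuts t _ _ (shrinks (⊆-trans (stable-branch-⊆ A B x) (∩-⊆ˡ (A ∩ B) (∁ (N x)))))))

  clique-⊆-N[] : ∀ {K x} → IsClique G K → x ∈ᵥ K → K ⊆ N[ x ]
  clique-⊆-N[] {x = x} K-clique x∈K j j∈K with j ≟ x
  ... | yes refl = refl
  ... | no j≢x   = ∨-true⁺ʳ (K-clique x j x∈K j∈K (j≢x ∘ sym))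

  stable-⊆-∁N : ∀ {S y} → IsStable G S → y ∈ᵥ S → S ⊆ ∁ (N y)
  stable-⊆-∁N {y = y} S-stable y∈S j j∈S = not-true⁺ (S-stable y j y∈S j∈S)

  finalCut-separates : ∀ {A B K S} → K ⊆ A → S ⊆ B →
    (∀ x → x ∈ᵥ K → x ∈ᵥ (A ∩ B) → count (A ∩ B) < 2 * deg (A ∩ B) x) →
    (∀ y → y ∈ᵥ S → y ∈ᵥ (A ∩ B) → count (A ∩ B) < 2 * nonDeg (A ∩ B) y) →
    Separates (finalCut A B) K S
  finalCut-separates {A} {B} {K} {S} K⊆A S⊆B K-heavy S-light = K⊆W , S∩W=∅
    where
    C : VSet n
    C = A ∩ B
    K⊆W : K ⊆ finalCut A B
    K⊆W j j∈K with B j Bool.≟ true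
    ... | no  b = ∨-true⁺ˡ (∧-true⁺ (K⊆A j j∈K) (not-true⁺ (¬-not b)))
    ... | yes b = ∨-true⁺ʳ (∧-true⁺ j∈C (dec-true (count C <? 2 * deg C j) (K-heavy j j∈K j∈C)))
      where j∈C : j ∈ᵥ C
            j∈C = ∧-true⁺ (K⊆A j j∈K) b
    S∩W=∅ : ∀ j → j ∈ᵥ S → finalCut A B j ≡ false
    S∩W=∅ j j∈S = ¬-not λ j∈W → case ∨-true⁻ ((A ∖ B) j) j∈W of λ where
      (inj₁ j∈A∖B)    → not-true⁻ (B j) (proj₂ (∧-true⁻ (A j) j∈A∖B)) (S⊆B j j∈S)
      (inj₂ j∈heavyC) → let j∈C , j-heavy = ∧-true⁻ (C j) j∈heavyC in
        no-two-majorities (deg C j) (nonDeg C j) (count-∩+count-∖ C (N j))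
          (from-does (count C <? 2 * deg C j) j-heavy) (S-light j j∈S j∈C)

  module _ {K S : VSet n} (K-clique : IsClique G K) (S-stable : IsStable G S)
           (K∩S=∅ : Disjoint K S) where

    cuts-separate : ∀ t A B → count (A ∩ B) < 2 ^ t → K ⊆ A → S ⊆ B →
                    ∃[ W ] (W ∈ cuts t A B × Separates W K S)
    cuts-separate zero A B |C|<1 K⊆A S⊆B =
      finalCut A B , here refl ,
      finalCut-separates K⊆A S⊆B (λ _ _ → ⊥-elim ∘ C-empty) (λ _ _ → ⊥-elim ∘ C-empty)
      where
      C-empty : ∀ {x} → ¬ x ∈ᵥ (A ∩ B)
      C-empty x∈C = ≤⇒≯ (count>0 (A ∩ B) x∈C) |C|<1
    cuts-separate (suc t) A B |C|<2^[1+t] K⊆A S⊆B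
      with light-or-heavy K (A ∩ B) (deg (A ∩ B)) | light-or-heavy S (A ∩ B) (nonDeg (A ∩ B))
    ... | inj₁ (x , x∈K , x∈C , light) | _ =
      let W , W∈ , W-separates = cuts-separate t (A ∩ N[ x ]) (B ∖ ⁅ x ⁆)
            (≤-<-trans (count-mono (clique-branch-⊆ A B x)) (halve t light |C|<2^[1+t]))
            (⊆-∩ K⊆A (clique-⊆-N[] K-clique x∈K))
            (⊆-∩ S⊆B (⊆-∁⁅⁆ S (K∩S=∅ x x∈K)))
      in W , there (∈-concatWhere (A ∩ B) _ x∈C (∈-++⁺ˡ W∈)) , W-separates
    ... | inj₂ _ | inj₁ (y , y∈S , y∈C , light) =
      let W , W∈ , W-separates = cuts-separate t (A ∖ ⁅ y ⁆) (B ∖ N y)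
            (≤-<-trans (count-mono (stable-branch-⊆ A B y)) (halve t light |C|<2^[1+t]))
            (⊆-∩ K⊆A (⊆-∁⁅⁆ K λ y∈K → K∩S=∅ y y∈K y∈S))
            (⊆-∩ S⊆B (stable-⊆-∁N S-stable y∈S))
      in W , there (∈-concatWhere (A ∩ B) _ y∈C (∈-++⁺ʳ _ W∈)) , W-separates
    ... | inj₂ K-heavy | inj₂ S-light =
      finalCut A B , here refl , finalCut-separates K⊆A S⊆B K-heavy S-light

  later forward : Fin n → VSet n
  later i j = toℕ i <ᵇ toℕ j
  forward i = later i ∩ N i

  cutsFrom : Fin n → ℕ → List (Cut n)
  cutsFrom i t = cuts t (⁅ i ⁆ ∪ forward i) (∁ ⁅ i ⁆)

  family : (Fin n → ℕ) → List (Cut n)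
  family depth = ∅ ∷ concatWhere (λ _ → true) (λ i → cutsFrom i (depth i))

  family-separates : ∀ depth → (∀ i → count (forward i) < 2 ^ depth i) → IsCSSeparator G (family depth)
  family-separates depth small K S K-clique S-stable K∩S=∅ with empty-or-least K
  ... | inj₁ K-empty = ∅ , here refl , (λ j j∈K → ⊥-elim (not-¬ (K-empty j) j∈K)) , (λ _ _ → refl)
  ... | inj₂ (i , i∈K , i-least) =
    let W , W∈ , W-separates =
          cuts-separate K-clique S-stable K∩S=∅ (depth i) (⁅ i ⁆ ∪ forward i) (∁ ⁅ i ⁆)
            (≤-<-trans (count-mono (∪-∖-⊆ ⁅ i ⁆ (forward i))) (small i)) K⊆i∪forward (⊆-∁⁅⁆ S (K∩S=∅ i i∈K))
    in W , there (∈-concatWhere (λ _ → true) (λ i → cutsFrom i (depth i)) refl W∈) , W-separates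
    where
    K⊆i∪forward : K ⊆ ⁅ i ⁆ ∪ forward i
    K⊆i∪forward j j∈K with j ≟ i
    ... | yes refl = refl
    ... | no j≢i =
      ∨-true⁺ʳ (∧-true⁺ (Equivalence.to T-≡ (<⇒<ᵇ i<j)) (K-clique i j i∈K j∈K (j≢i ∘ sym)))
      where i<j : toℕ i < toℕ j
            i<j = ≤∧≢⇒< (i-least j j∈K) (j≢i ∘ sym ∘ toℕ-injective)

  length-family : ∀ depth M → (∀ i → (1 + 2 * count (forward i)) ^ depth i ≤ M) →
                  length (family depth) ≤ 1 + n * M
  length-family depth M bound =
    s≤s (≤-trans (length-concatWhere (λ _ → true) (λ i → cutsFrom i (depth i)) M λ i _ →
                    ≤-trans (length-cuts (depth i) _ _ (count-mono (∪-∖-⊆ ⁅ i ⁆ (forward i)))) (bound i))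
                 (≤-reflexive (cong (_* M) (count-⊤ {n}))))

  forward-separator : ∀ M →
    (∀ i → ∃[ t ] (count (forward i) < 2 ^ t × (1 + 2 * count (forward i)) ^ t ≤ M)) →
    ∃[ F ] (IsCSSeparator G F × length F ≤ 1 + n * M)
  forward-separator M depth-of =
    family depth ,
    family-separates depth (proj₁ ∘ proj₂ ∘ depth-of) ,
    length-family depth M (proj₂ ∘ proj₂ ∘ depth-of)
    where
    depth : Fin n → ℕ
    depth = proj₁ ∘ depth-of

bit-length : ∀ k → ∃[ w ] (k < 2 ^ (2 + w) × (w ≡ 0 ⊎ 2 ^ w < k))
bit-length zero = 0 , s≤s z≤n , inj₁ refl
bit-length (suc k) with bit-length k
... | w , k<2^[2+w] , w-small with suc k <? 2 ^ (2 + w)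
...   | yes 1+k<2^[2+w] = w , 1+k<2^[2+w] , Sum.map₂ m<n⇒m<1+n w-small
...   | no  1+k≮2^[2+w] = suc w , 1+k<2^[3+w] , inj₂ 2^[1+w]<1+k
  where
  1+k≡2^[2+w] : suc k ≡ 2 ^ (2 + w)
  1+k≡2^[2+w] = ≤-antisym k<2^[2+w] (≮⇒≥ 1+k≮2^[2+w])
  1+k<2^[3+w] : suc k < 2 ^ (3 + w)
  1+k<2^[3+w] = subst (_< 2 ^ (3 + w)) (sym 1+k≡2^[2+w]) (^-monoʳ-< 2 (s≤s (s≤s z≤n)) (n<1+n (2 + w)))
  2^[1+w]<1+k : 2 ^ (1 + w) < suc k
  2^[1+w]<1+k = subst (2 ^ (1 + w) <_) (sym 1+k≡2^[2+w]) (^-monoʳ-< 2 (s≤s (s≤s z≤n)) (n<1+n (1 + w)))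

5w≤w²+25 : ∀ w → 5 * w ≤ w * w + 25
5w≤w²+25 w with w ≤? 5
... | yes w≤5 = ≤-trans (*-monoʳ-≤ 5 w≤5) (m≤n+m 25 (w * w))
... | no  w≰5 = ≤-trans (*-monoˡ-≤ w (<⇒≤ (≰⇒> w≰5))) (m≤m+n (w * w) 25)

exponent-bound : ∀ w → (3 + w) * (2 + w) ≤ w * w + w * w + 31
exponent-bound w = begin
  (3 + w) * (2 + w)        ≡⟨ expand w ⟩
  w * w + 5 * w + 6        ≤⟨ +-monoˡ-≤ 6 (+-monoʳ-≤ (w * w) (5w≤w²+25 w)) ⟩
  w * w + (w * w + 25) + 6 ≡⟨ regroup w ⟩
  w * w + w * w + 31       ∎
  where
  open ≤-Reasoning
  expand : ∀ w → (3 + w) * (2 + w) ≡ w * w + 5 * w + 6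
  expand = solve-∀
  regroup : ∀ w → w * w + (w * w + 25) + 6 ≡ w * w + w * w + 31
  regroup = solve-∀

1≤m⇒1≤m^k : ∀ {m} k → 1 ≤ m → 1 ≤ m ^ k
1≤m⇒1≤m^k {m} k 1≤m = subst (_≤ m ^ k) (^-zeroˡ k) (^-monoˡ-≤ k 1≤m)

-- 2^w < k says w < log₂ k, so the hypothesis at u = w, v = 1 gives w² ≤ s² log₂ n.
square-log-bound : ∀ n p q {k w} → 1 ≤ q → 1 ≤ n → BoundedBy n p q k →
                   w ≡ 0 ⊎ 2 ^ w < k → 2 ^ (w * w) ≤ n ^ (p * p)
square-log-bound n p q 1≤q 1≤n bounded (inj₁ refl) = 1≤m⇒1≤m^k (p * p) 1≤n
square-log-bound n p q {k} {w} 1≤q 1≤n bounded (inj₂ 2^w<k) = begin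
  2 ^ (w * w)                ≡⟨ cong (2 ^_) (*-identityʳ (w * w)) ⟨
  2 ^ (w * w * 1)            ≤⟨ ^-monoʳ-≤ 2 (*-monoʳ-≤ (w * w) (*-mono-≤ 1≤q 1≤q)) ⟩
  2 ^ (w * w * (q * q))      ≤⟨ bounded w 1 ≤-refl (subst (2 ^ w <_) (sym (*-identityʳ k)) 2^w<k) ⟩
  n ^ (p * p * 1)            ≡⟨ cong (n ^_) (*-identityʳ (p * p)) ⟩
  n ^ (p * p)                ∎
  where open ≤-Reasoning

depth-bound : ∀ n p q {k} → 1 ≤ q → 2 ≤ n → BoundedBy n p q k →
              ∃[ t ] (k < 2 ^ t × (1 + 2 * k) ^ t ≤ n ^ (p * p + p * p + 31))
depth-bound n p q {k} 1≤q 2≤n bounded with bit-length k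
... | w , k<2^[2+w] , w-small = 2 + w , k<2^[2+w] , size
  where
  2^w²≤n^p² : 2 ^ (w * w) ≤ n ^ (p * p)
  2^w²≤n^p² = square-log-bound n p q 1≤q (<⇒≤ 2≤n) bounded w-small
  1+2k≤2^[3+w] : 1 + 2 * k ≤ 2 ^ (3 + w)
  1+2k≤2^[3+w] = ≤-trans (n≤1+n _) (subst (_≤ 2 ^ (3 + w)) (*-suc 2 k) (*-monoʳ-≤ 2 k<2^[2+w]))
  size : (1 + 2 * k) ^ (2 + w) ≤ n ^ (p * p + p * p + 31)
  size = begin
    (1 + 2 * k) ^ (2 + w)                 ≤⟨ ^-monoˡ-≤ (2 + w) 1+2k≤2^[3+w] ⟩
    (2 ^ (3 + w)) ^ (2 + w)               ≡⟨ ^-*-assoc 2 (3 + w) (2 + w) ⟩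
    2 ^ ((3 + w) * (2 + w))               ≤⟨ ^-monoʳ-≤ 2 (exponent-bound w) ⟩
    2 ^ (w * w + w * w + 31)              ≡⟨ split-exponent 2 (w * w) ⟩
    2 ^ (w * w) * 2 ^ (w * w) * 2 ^ 31    ≤⟨ *-mono-≤ (*-mono-≤ 2^w²≤n^p² 2^w²≤n^p²) (^-monoˡ-≤ 31 2≤n) ⟩
    n ^ (p * p) * n ^ (p * p) * n ^ 31    ≡⟨ split-exponent n (p * p) ⟨
    n ^ (p * p + p * p + 31)              ∎
    where
    open ≤-Reasoning
    split-exponent : ∀ m e → m ^ (e + e + 31) ≡ m ^ e * m ^ e * m ^ 31
    split-exponent m e = trans (^-distribˡ-+-* m (e + e) 31) (cong (_* m ^ 31) (^-distribˡ-+-* m e e))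

1+n*M≤n²*M : ∀ {n M} → 2 ≤ n → 1 ≤ M → 1 + n * M ≤ n * (n * M)
1+n*M≤n²*M {n} {M} 2≤n 1≤M = begin
  1 + n * M         ≤⟨ +-monoˡ-≤ (n * M) (*-mono-≤ (<⇒≤ 2≤n) 1≤M) ⟩
  n * M + n * M     ≡⟨ cong (n * M +_) (+-identityʳ (n * M)) ⟨
  2 * (n * M)       ≤⟨ *-monoˡ-≤ (n * M) 2≤n ⟩
  n * (n * M)       ∎
  where open ≤-Reasoning

relabel : Graph n → Permutation′ n → Graph n
relabel G σ = record
  { adj   = λ i j → adj G (σ ⟨$⟩ʳ i) (σ ⟨$⟩ʳ j)
  ; sym   = λ i j → Graph.sym G (σ ⟨$⟩ʳ i) (σ ⟨$⟩ʳ j)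
  ; irrfl = λ i → irrfl G (σ ⟨$⟩ʳ i)
  }

relabel-separator : ∀ (G : Graph n) σ {m} →
  ∃[ F ] (IsCSSeparator (relabel G σ) F × length F ≤ m) → ∃[ F ] (IsCSSeparator G F × length F ≤ m)
relabel-separator G σ (F , separates , |F|≤m) =
  map (_∘ (σ ⟨$⟩ˡ_)) F , separates-G , ≤-trans (≤-reflexive (length-map _ F)) |F|≤m
  where
  separates-G : IsCSSeparator G (map (_∘ (σ ⟨$⟩ˡ_)) F)
  separates-G K S K-clique S-stable K∩S=∅ =
    let W , W∈ , K⊆W , S∩W=∅ = separates (K ∘ (σ ⟨$⟩ʳ_)) (S ∘ (σ ⟨$⟩ʳ_))
          (λ u v u∈K v∈K u≢v → K-clique _ _ u∈K v∈K (u≢v ∘ Injection.injective (Inverse⇒Injection σ)))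
          (λ u v u∈S v∈S → S-stable _ _ u∈S v∈S)
          (λ v → K∩S=∅ (σ ⟨$⟩ʳ v))
    in W ∘ (σ ⟨$⟩ˡ_) , ∈-map⁺ _ W∈ ,
       (λ v v∈K → K⊆W _ (subst (_∈ᵥ K) (sym (inverseʳ σ)) v∈K)) ,
       (λ v v∈S → S∩W=∅ _ (subst (_∈ᵥ S) (sym (inverseʳ σ)) v∈S))

theorem4 : ∀ (p q : ℕ) → 1 ≤ p → 1 ≤ q →
    ∃[ d ] (∀ (n : ℕ) → 2 ≤ n → (G : Graph n) → (σ : Permutation′ n) →
      (∀ (i : Fin n) → BoundedBy n p q (fwdDeg G σ i)) →
      ∃[ F ] (IsCSSeparator G F × length F ≤ n ^ d))
theorem4 p q _ 1≤q = 2 + D , λ n 2≤n G σ bounded →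
  let F , F-separates , |F|≤1+n*n^D = relabel-separator G σ
        (CliqueStableCuts.forward-separator (relabel G σ) (n ^ D)
          (λ i → depth-bound n p q 1≤q 2≤n (bounded i)))
  in F , F-separates , ≤-trans |F|≤1+n*n^D (1+n*M≤n²*M 2≤n (1≤m⇒1≤m^k D (<⇒≤ 2≤n)))
  where
  D : ℕ
  D = p * p + p * p + 31
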